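{- Let $L_5=\{ -3,-2,-1,0,1\}$ with its natural order. Define games over $L_5$: $\star=\{ -1\mid -3\}$, and for a game $G$: $M(G)=\{1\mid G\}$, $P(G)=\{G\mid -2\}$, $P_\star(G)=\{G\mid \star\}$; for $n\in\mathbb{N}$ let $P_n(G)=P(G)$ if $n$ is odd and $P_n(G)=P_\star(G)$ if $n$ is even. Define $G_0=0$ (the atomic game $[0]$) and $G_{n+1}=M(P_n(G_n))$. Then for all $n\in\mathbb{N}$, $G_{n+1}\not\leq G_n$.
   Context: Games over a poset $A$ (whose elements are called atoms) are defined inductively: for each $a\in A$, $[a]$ is a game (atomic game, often written simply $a$); and whenever $L$ and $R$ are non-empty sets of games, $\{L\mid R\}$ is a game, whose elements of $L$ (resp. $R$) are its left options $G^L$ (resp. right options $G^R$); $\{G_1,\dots\mid H_1,\dots\}$ denotes the game with those left and right options. Relations $\leq$ and $\lhd$ are defined by mutual recursion: $G\leq H$ iff (1) every left option $G^L$ satisfies $G^L\lhd H$, (2) every right option $H^R$ satisfies $G\lhd H^R$, and (3) if $G$ or $H$ is atomic then $G\lhd H$. And $G\lhd H$ iff at least one of: (1) some right option $G^R$ satisfies $G^R\leq H$, (2) some left option $H^L$ satisfies $G\leq H^L$, (3) $G=[a]$, $H=[b]$ are atomic with $a\leq b$. -}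

module Defs where

open import Data.List.NonEmpty using (List⁺; [_]; toList)
open import Data.List using (List; [])
open import Data.List.Membership.Propositional using (_∈_)
open import Data.Nat using (ℕ; zero; suc)
open import Data.Nat.Base using (_%_)
open import Data.Integer using (ℤ; +_; -[1+_]) renaming (_≤_ to _≤ℤ_)
open import Data.Sum using (_⊎_)
open import Data.Product using (∃; _×_)
open import Relation.Binary.PropositionalEquality using (_≡_)

-- Games over a set of atoms A with an order _≤ₐ_ (only the order is used
-- by the definitions).  Sets of options are finite non-empty lists.

module Games (A : Set) (_≤ₐ_ : A → A → Set) where

  data Game : Set where
    atom  : A → Game
    ⟨_∣_⟩ : List⁺ Game → List⁺ Game → Game

  lefts : Game → List Game
  lefts (atom _)  = []
  lefts ⟨ L ∣ R ⟩ = toList L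

  rights : Game → List Game
  rights (atom _)  = []
  rights ⟨ L ∣ R ⟩ = toList R

  data IsAtomic : Game → Set where
    atomic : ∀ a → IsAtomic (atom a)

  infix 4 _≤ᵍ_ _⊲_

  mutual
    data _≤ᵍ_ (G H : Game) : Set where
      le : (∀ {GL} → GL ∈ lefts G → GL ⊲ H)
         → (∀ {HR} → HR ∈ rights H → G ⊲ HR)
         → (IsAtomic G ⊎ IsAtomic H → G ⊲ H)
         → G ≤ᵍ H

    data _⊲_ : Game → Game → Set where
      ⊲-right : ∀ {G H GR} → GR ∈ rights G → GR ≤ᵍ H → G ⊲ H
      ⊲-left  : ∀ {G H HL} → HL ∈ lefts H → G ≤ᵍ HL → G ⊲ H
      ⊲-atom  : ∀ {a b} → a ≤ₐ b → atom a ⊲ atom b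

data L₅ : Set where
  m3 m2 m1 z0 p1 : L₅

toℤ : L₅ → ℤ
toℤ m3 = -[1+ 2 ]
toℤ m2 = -[1+ 1 ]
toℤ m1 = -[1+ 0 ]
toℤ z0 = + 0
toℤ p1 = + 1

_≤L_ : L₅ → L₅ → Set
a ≤L b = toℤ a ≤ℤ toℤ b

open Games L₅ _≤L_ public

⋆ : Game
⋆ = ⟨ [ atom m1 ] ∣ [ atom m3 ] ⟩

M : Game → Game
M G = ⟨ [ atom p1 ] ∣ [ G ] ⟩

P : Game → Game
P G = ⟨ [ G ] ∣ [ atom m2 ] ⟩

P⋆ : Game → Game
P⋆ G = ⟨ [ G ] ∣ [ ⋆ ] ⟩

Pₙ : ℕ → Game → Game
Pₙ n G with n % 2
... | zero  = P⋆ G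
... | suc _ = P G

𝔾 : ℕ → Game
𝔾 zero    = atom z0
𝔾 (suc n) = M (Pₙ n (𝔾 n))

{-# OPTIONS --safe #-}
module Submission where

-- Write Gₙ₊₁ = M Hₙ with Hₙ = Pₙ(Gₙ) (tower, P-tower), whose right option Sₙ
-- (spoiler) alternates between ⋆ (n even) and -2 (n odd).  We show Gₘ ≰ Gₖ for
-- all k < m by induction on k.  Unfolding Gₘ ≤ Gₖ₊₁ twice either reaches some
-- Gₘ′ ≤ Gₖ with k < m′ or yields Hₘ₋₁ ≤ Hₖ and Hₘ₋₂ ≤ Hₖ.  Since Gₙ ⊲ -1 never
-- holds, Hⱼ ⊲ Sₖ forces Sⱼ ≤ Sₖ; so both Sₘ₋₁ and Sₘ₋₂ would be ≤ Sₖ, but one of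
-- them is ⋆, the other is -2, and these two are incomparable.

open import Defs
open import Data.Nat using (ℕ; suc; zero; _%_; _<_; s≤s)
open import Data.Nat.Properties using (n<1+n; m<n⇒m<1+n)
open import Data.Integer using (-≤-; +≤+)
open import Data.List.NonEmpty using ([_])
open import Data.List.Relation.Unary.Any using (here; there)
open import Data.List.Membership.Propositional using (_∈_)
open import Data.Sum using (_⊎_; inj₁; inj₂)
open import Data.Empty using (⊥-elim)
open import Relation.Binary.PropositionalEquality using (_≡_; refl; subst)
open import Relation.Nullary using (¬_)

≤ᵍ⇒left⊲ : ∀ {G H GL} → G ≤ᵍ H → GL ∈ lefts G → GL ⊲ H
≤ᵍ⇒left⊲ (le lefts⊲ _ _) = lefts⊲

≤ᵍ⇒⊲right : ∀ {G H HR} → G ≤ᵍ H → HR ∈ rights H → G ⊲ HR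
≤ᵍ⇒⊲right (le _ ⊲rights _) = ⊲rights

⊲-atom-inv : ∀ {a b} → atom a ⊲ atom b → a ≤L b
⊲-atom-inv (⊲-right () _)
⊲-atom-inv (⊲-left () _)
⊲-atom-inv (⊲-atom a≤b) = a≤b

⊲-unary-inv : ∀ {GL GR HL HR} → ⟨ [ GL ] ∣ [ GR ] ⟩ ⊲ ⟨ [ HL ] ∣ [ HR ] ⟩ →
              GR ≤ᵍ ⟨ [ HL ] ∣ [ HR ] ⟩ ⊎ ⟨ [ GL ] ∣ [ GR ] ⟩ ≤ᵍ HL
⊲-unary-inv (⊲-right (here refl) GR≤H) = inj₁ GR≤H
⊲-unary-inv (⊲-right (there ()) _)
⊲-unary-inv (⊲-left (here refl) G≤HL) = inj₂ G≤HL
⊲-unary-inv (⊲-left (there ()) _)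

⋆≰-2 : ¬ ⋆ ≤ᵍ atom m2
⋆≰-2 ⋆≤-2 with ⊲-atom-inv (≤ᵍ⇒left⊲ ⋆≤-2 (here refl))
... | -≤- ()

-2≰⋆ : ¬ atom m2 ≤ᵍ ⋆
-2≰⋆ -2≤⋆ with ⊲-atom-inv (≤ᵍ⇒⊲right -2≤⋆ (here refl))
... | -≤- (s≤s ())

spoiler : ℕ → Game
spoiler n with n % 2
... | zero  = ⋆
... | suc _ = atom m2

Pₙ≡spoiler : ∀ n G → Pₙ n G ≡ ⟨ [ G ] ∣ [ spoiler n ] ⟩
Pₙ≡spoiler n G with n % 2
... | zero  = refl
... | suc _ = refl

spoiler-lefts : ∀ k {L} → L ∈ lefts (spoiler k) → L ≡ atom m1
spoiler-lefts zero (here refl) = refl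
spoiler-lefts zero (there ())
spoiler-lefts (suc zero) ()
spoiler-lefts (suc (suc k)) = spoiler-lefts k

spoilers-incomparable : ∀ n k → spoiler (suc n) ≤ᵍ spoiler k → ¬ spoiler n ≤ᵍ spoiler k
spoilers-incomparable (suc (suc n)) k = spoilers-incomparable n k
spoilers-incomparable n (suc (suc k)) = spoilers-incomparable n k
spoilers-incomparable zero zero S₁≤S₀ _ = -2≰⋆ S₁≤S₀
spoilers-incomparable zero (suc zero) _ S₀≤S₁ = ⋆≰-2 S₀≤S₁
spoilers-incomparable (suc zero) zero _ S₁≤S₀ = -2≰⋆ S₁≤S₀
spoilers-incomparable (suc zero) (suc zero) S₀≤S₁ _ = ⋆≰-2 S₀≤S₁

-- 𝔾 with Pₙ unfolded: Pₙ n is stuck on n % 2, so options of 𝔾 (suc n) are not visible.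
mutual
  tower : ℕ → Game
  tower zero    = atom z0
  tower (suc n) = M (P-tower n)

  P-tower : ℕ → Game
  P-tower n = ⟨ [ tower n ] ∣ [ spoiler n ] ⟩

𝔾≡tower : ∀ n → 𝔾 n ≡ tower n
𝔾≡tower zero = refl
𝔾≡tower (suc n) rewrite Pₙ≡spoiler n (𝔾 n) | 𝔾≡tower n = refl

mutual
  tower-⋪-1 : ∀ n → ¬ tower n ⊲ atom m1
  tower-⋪-1 zero G₀⊲-1 with ⊲-atom-inv G₀⊲-1
  ... | ()
  tower-⋪-1 (suc n) (⊲-right (here refl) Hₙ≤-1) = P-tower-≰-1 n Hₙ≤-1
  tower-⋪-1 (suc n) (⊲-right (there ()) _)
  tower-⋪-1 (suc n) (⊲-left () _)

  P-tower-≰-1 : ∀ n → ¬ P-tower n ≤ᵍ atom m1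
  P-tower-≰-1 n Hₙ≤-1 = tower-⋪-1 n (≤ᵍ⇒left⊲ Hₙ≤-1 (here refl))

P-tower-⊲-spoiler : ∀ n k → P-tower n ⊲ spoiler k → spoiler n ≤ᵍ spoiler k
P-tower-⊲-spoiler n k (⊲-right (here refl) Sₙ≤Sₖ) = Sₙ≤Sₖ
P-tower-⊲-spoiler n k (⊲-right (there ()) _)
P-tower-⊲-spoiler n k (⊲-left L∈ Hₙ≤L) =
  ⊥-elim (P-tower-≰-1 n (subst (P-tower n ≤ᵍ_) (spoiler-lefts k L∈) Hₙ≤L))

tower-≰ : ∀ {k m} → k < m → ¬ tower m ≤ᵍ tower k
tower-≰ {zero} {suc m} _ Gₘ≤G₀ with ⊲-atom-inv (≤ᵍ⇒left⊲ Gₘ≤G₀ (here refl))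
... | +≤+ ()
tower-≰ {suc k} {suc zero} (s≤s ())
tower-≰ {suc k} {suc (suc m)} (s≤s k<1+m) Gₘ₊₂≤Gₖ₊₁
  with ⊲-unary-inv (≤ᵍ⇒⊲right Gₘ₊₂≤Gₖ₊₁ (here refl))
... | inj₂ Gₘ₊₂≤Gₖ = tower-≰ (m<n⇒m<1+n k<1+m) Gₘ₊₂≤Gₖ
... | inj₁ Hₘ₊₁≤Hₖ with ⊲-unary-inv (≤ᵍ⇒left⊲ Hₘ₊₁≤Hₖ (here refl))
...   | inj₂ Gₘ₊₁≤Gₖ = tower-≰ k<1+m Gₘ₊₁≤Gₖ
...   | inj₁ Hₘ≤Hₖ = spoilers-incomparable m k
          (P-tower-⊲-spoiler (suc m) k (≤ᵍ⇒⊲right Hₘ₊₁≤Hₖ (here refl)))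
          (P-tower-⊲-spoiler m k (≤ᵍ⇒⊲right Hₘ≤Hₖ (here refl)))

lemma4 : ∀ (n : ℕ) → ¬ (𝔾 (suc n) ≤ᵍ 𝔾 n)
lemma4 n rewrite 𝔾≡tower (suc n) | 𝔾≡tower n = tower-≰ (n<1+n n)
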